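{- Let $k\ge 2$ and let $\mathcal{P}_k$ be a set of patterns such that for every ordered matching $M$, $\mathrm{mn}(M)\le k$ if and only if $M$ contains no pattern from $\mathcal{P}_k$. Then $\mathcal{P}_k$ is infinite.
   Context: An ordered graph is a graph $G$ with a total order $\prec$ on $V(G)$; an ordered matching is an ordered graph of maximum degree at most one. Two edges $uv$, $xy$ ($u\prec v$, $x\prec y$, four distinct endpoints) cross if $u\prec x\prec v\prec y$ or $x\prec u\prec y\prec v$, and nest if $u\prec x\prec y\prec v$ or $x\prec u\prec v\prec y$. A stack is an edge set with no two crossing edges, a queue one with no two nesting edges. $\mathrm{mn}(G)$ is the minimum $s+q$ such that the edges of $G$ can be partitioned into $s$ stacks and $q$ queues with respect to the given order. A pattern is an ordered graph with at least one edge; an ordered graph contains a pattern $H$ if it has a subgraph isomorphic to $H$ via an order-preserving isomorphism, and avoids it otherwise. -}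

module Defs where

open import Data.Nat using (ℕ; _+_; _≤_)
open import Data.Fin using (Fin; _<_)
open import Data.Bool using (Bool; true)
open import Data.Product using (Σ; ∃; _×_; _,_)
open import Data.Sum using (_⊎_; inj₁; inj₂)
open import Data.List using (List)
open import Data.List.Relation.Unary.Any using (Any)
open import Relation.Binary.PropositionalEquality using (_≡_)
open import Relation.Nullary using (¬_)

-- An ordered graph: vertex set Fin n, ordered by the natural order of Fin n
-- (every finite totally ordered set is uniquely order-isomorphic to such).
-- The edge {i,j} with i < j is present iff adj i j ≡ true; entries adj i j
-- with ¬ (i < j) are irrelevant.
record OGraph : Set where
  constructor ograph
  field
    n   : ℕ
    adj : Fin n → Fin n → Bool
open OGraph public

Edge : (G : OGraph) → Fin (n G) → Fin (n G) → Set
Edge G i j = (i < j) × (adj G i j ≡ true)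

Adj : (G : OGraph) → Fin (n G) → Fin (n G) → Set
Adj G i j = Edge G i j ⊎ Edge G j i

IsMatching : OGraph → Set
IsMatching G = ∀ v u w → Adj G v u → Adj G v w → u ≡ w

IsPattern : OGraph → Set
IsPattern H = Σ (Fin (n H)) λ i → Σ (Fin (n H)) λ j → Edge H i j

StrictMono : {a b : ℕ} → (Fin a → Fin b) → Set
StrictMono f = ∀ i j → i < j → f i < f j

-- G contains H: some order-preserving injection maps every edge of H
-- to an edge of G (a not necessarily induced ordered subgraph)
Contains : OGraph → OGraph → Set
Contains G H = Σ (Fin (n H) → Fin (n G)) λ f →
  StrictMono f × (∀ i j → Edge H i j → Edge G (f i) (f j))

Iso : OGraph → OGraph → Set
Iso G H = Σ (Fin (n G) → Fin (n H)) λ f → Σ (Fin (n H) → Fin (n G)) λ g →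
  StrictMono f × StrictMono g ×
  (∀ x → g (f x) ≡ x) × (∀ y → f (g y) ≡ y) ×
  (∀ i j → i < j → adj G i j ≡ adj H (f i) (f j))

Cross : {m : ℕ} → Fin m → Fin m → Fin m → Fin m → Set
Cross u v x y = (u < x × x < v × v < y) ⊎ (x < u × u < y × y < v)

Nest : {m : ℕ} → Fin m → Fin m → Fin m → Fin m → Set
Nest u v x y = (u < x × x < y × y < v) ⊎ (x < u × u < v × v < y)

-- The colouring assigns each edge (i<j) a stack (inj₁) or a
-- queue (inj₂); it is a function on all pairs but only its values on edges matter.
MnAtMost : ℕ → OGraph → Set
MnAtMost k G = Σ ℕ λ s → Σ ℕ λ q → (s + q ≤ k) ×
  Σ (Fin (n G) → Fin (n G) → Fin s ⊎ Fin q) λ c →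
    (∀ u v x y (a : Fin s) → Edge G u v → Edge G x y →
       c u v ≡ inj₁ a → c x y ≡ inj₁ a → ¬ Cross u v x y) ×
    (∀ u v x y (b : Fin q) → Edge G u v → Edge G x y →
       c u v ≡ inj₂ b → c x y ≡ inj₂ b → ¬ Nest u v x y)

FiniteUpToIso : (OGraph → Set) → Set
FiniteUpToIso P = Σ (List OGraph) λ L → ∀ H → P H → Any (Iso H) L

Avoids : OGraph → (OGraph → Set) → Set
Avoids G P = ¬ (Σ OGraph λ H → P H × Contains G H)

-- For k = t + 2 let M consist of t mutually nested groups of t + 3 pairwise crossing chords; inside
-- them two mutually crossing rainbows of t + 3 pairwise nesting chords; and innermost an odd cycle
-- of 2m + 3 chords, each crossing exactly its two neighbours.  By pigeonhole every group needs a
-- queue, and these t queues differ because the groups nest; each rainbow needs a stack, and the two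
-- differ because the rainbows cross.  The odd cycle cannot be coloured with those two stacks, and
-- its extra colour is none of the t queues since the cycle is nested in every group: mn(M) > k.
-- Deleting any path chord of the cycle leaves mn ≤ k.  If P were finite, with all its patterns on
-- at most m vertices, M would contain some H ∈ P; H misses the left end of one of the 2m + 2 path
-- chords, so H lies in M minus that chord and mn(H) ≤ k, although H contains H ∈ P.

module Submission where

open import Defs
open import Data.Nat using (ℕ; _≤_)
open import Data.Product using (_×_)
open import Relation.Nullary using (¬_)

open import Data.Bool using (Bool; true; T)
import Data.Bool.Properties as Boolₚ
open import Data.Empty using (⊥)
open import Data.Fin using (Fin; zero; suc; toℕ; fromℕ<; combine; opposite; join; splitAt)
import Data.Fin.Properties as Finₚ
open import Data.List using (List; []; _∷_)
open import Data.List.Relation.Unary.Any using (Any; here; there)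
open import Data.Nat using (zero; suc; _+_; _*_; _∸_; _⊔_; _<_; _<ᵇ_; z≤n; s≤s; z<s; s<s; s≤s⁻¹)
open import Data.Nat using (_≤′_; ≤′-reflexive; ≤′-step)
open import Data.Nat.DivMod using (_mod_; m<n⇒m%n≡m; m%n<n)
open import Data.Nat.Properties
open import Data.Product using (∃; ∃₂; _,_; proj₁; proj₂; map₂)
open import Data.Sum using (_⊎_; inj₁; inj₂)
import Data.Sum.Properties as Sumₚ
open import Data.Vec.Functional using (Vector) renaming ([] to []ᵥ; _∷_ to _∷ᵥ_)
open import Function using (_∘_; id; flip)
open import Function.Definitions using (Injective)
open import Relation.Binary.Definitions using (DecidableEquality; tri<; tri≈; tri>)
open import Relation.Binary.PropositionalEquality
open import Relation.Nullary using (Dec; yes; no; does; contradiction; ¬?)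
open import Relation.Nullary.Decidable using (dec-true; decidable-stable; map′; _×-dec_; _⊎-dec_)

private variable
  a b c d a′ b′ c′ d′ k s q : ℕ

-- Cross and Nest of Defs, at Fin, unfold definitionally to these at toℕ.
Crossℕ Nestℕ : ℕ → ℕ → ℕ → ℕ → Set
Crossℕ u v x y = (u < x × x < v × v < y) ⊎ (x < u × u < y × y < v)
Nestℕ u v x y = (u < x × x < y × y < v) ⊎ (x < u × u < v × v < y)

subst₄ : (R : ℕ → ℕ → ℕ → ℕ → Set) →
         a ≡ a′ → b ≡ b′ → c ≡ c′ → d ≡ d′ → R a b c d → R a′ b′ c′ d′
subst₄ R refl refl refl refl r = r

cross-sym : Crossℕ a b c d → Crossℕ c d a b
cross-sym (inj₁ p) = inj₂ p
cross-sym (inj₂ p) = inj₁ p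

nest-sym : Nestℕ a b c d → Nestℕ c d a b
nest-sym (inj₁ p) = inj₂ p
nest-sym (inj₂ p) = inj₁ p

cross-irrefl : ¬ Crossℕ a b a b
cross-irrefl (inj₁ (a<a , _)) = <-irrefl refl a<a
cross-irrefl (inj₂ (a<a , _)) = <-irrefl refl a<a

nest-irrefl : ¬ Nestℕ a b a b
nest-irrefl (inj₁ (a<a , _)) = <-irrefl refl a<a
nest-irrefl (inj₂ (a<a , _)) = <-irrefl refl a<a

nest⇒¬cross : Nestℕ a b c d → ¬ Crossℕ a b c d
nest⇒¬cross (inj₁ (_ , _ , d<b)) (inj₁ (_ , _ , b<d)) = <-asym d<b b<d
nest⇒¬cross (inj₁ (a<c , _)) (inj₂ (c<a , _)) = <-asym a<c c<a
nest⇒¬cross (inj₂ (c<a , _)) (inj₁ (a<c , _)) = <-asym a<c c<a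
nest⇒¬cross (inj₂ (_ , _ , b<d)) (inj₂ (_ , _ , d<b)) = <-asym d<b b<d

cross⇒¬nest : Crossℕ a b c d → ¬ Nestℕ a b c d
cross⇒¬nest = flip nest⇒¬cross

cross-shift : ∀ o → Crossℕ a b c d → Crossℕ (o + a) (o + b) (o + c) (o + d)
cross-shift o (inj₁ (p , q , r)) = inj₁ (+-monoʳ-< o p , +-monoʳ-< o q , +-monoʳ-< o r)
cross-shift o (inj₂ (p , q , r)) = inj₂ (+-monoʳ-< o p , +-monoʳ-< o q , +-monoʳ-< o r)

cross-unshift : ∀ o → Crossℕ (o + a) (o + b) (o + c) (o + d) → Crossℕ a b c d
cross-unshift o (inj₁ (p , q , r)) = inj₁ (+-cancelˡ-< o _ _ p , +-cancelˡ-< o _ _ q , +-cancelˡ-< o _ _ r)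
cross-unshift o (inj₂ (p , q , r)) = inj₂ (+-cancelˡ-< o _ _ p , +-cancelˡ-< o _ _ q , +-cancelˡ-< o _ _ r)

module _ {k : ℕ} (l r : Fin k → ℕ) where

  crossing-family⇒¬nest : (∀ {j j′} → toℕ j < toℕ j′ → Crossℕ (l j) (r j) (l j′) (r j′)) →
                          ∀ j j′ → ¬ Nestℕ (l j) (r j) (l j′) (r j′)
  crossing-family⇒¬nest cross j j′ with Finₚ.<-cmp j j′
  ... | tri< j<j′ _ _ = cross⇒¬nest (cross j<j′)
  ... | tri≈ _ refl _ = nest-irrefl
  ... | tri> _ _ j′<j = cross⇒¬nest (cross j′<j) ∘ nest-sym

  nesting-family⇒¬cross : (∀ {j j′} → toℕ j < toℕ j′ → Nestℕ (l j) (r j) (l j′) (r j′)) →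
                          ∀ j j′ → ¬ Crossℕ (l j) (r j) (l j′) (r j′)
  nesting-family⇒¬cross nest j j′ with Finₚ.<-cmp j j′
  ... | tri< j<j′ _ _ = nest⇒¬cross (nest j<j′)
  ... | tri≈ _ refl _ = cross-irrefl
  ... | tri> _ _ j′<j = nest⇒¬cross (nest j′<j) ∘ cross-sym

strictMono-injective : {f : Fin a → Fin b} → StrictMono f → Injective _≡_ _≡_ f
strictMono-injective mono {x} {y} fx≡fy with Finₚ.<-cmp x y
... | tri< x<y _ _ = contradiction (cong toℕ fx≡fy) (<⇒≢ (mono x y x<y))
... | tri≈ _ x≡y _ = x≡y
... | tri> _ _ y<x = contradiction (cong toℕ (sym fx≡fy)) (<⇒≢ (mono y x y<x))

strictMono-cross : {f : Fin a → Fin b} → StrictMono f →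
                   ∀ {u v x y} → Cross u v x y → Cross (f u) (f v) (f x) (f y)
strictMono-cross mono (inj₁ (p , q , r)) = inj₁ (mono _ _ p , mono _ _ q , mono _ _ r)
strictMono-cross mono (inj₂ (p , q , r)) = inj₂ (mono _ _ p , mono _ _ q , mono _ _ r)

strictMono-nest : {f : Fin a → Fin b} → StrictMono f →
                  ∀ {u v x y} → Nest u v x y → Nest (f u) (f v) (f x) (f y)
strictMono-nest mono (inj₁ (p , q , r)) = inj₁ (mono _ _ p , mono _ _ q , mono _ _ r)
strictMono-nest mono (inj₂ (p , q , r)) = inj₂ (mono _ _ p , mono _ _ q , mono _ _ r)

iso-size : ∀ {G H} → Iso H G → n H ≤ n G
iso-size (_ , _ , mono , _) = Finₚ.injective⇒≤ (strictMono-injective mono)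

maxSize : List OGraph → ℕ
maxSize [] = 0
maxSize (G ∷ Gs) = n G ⊔ maxSize Gs

iso-member-size : ∀ {H Gs} → Any (Iso H) Gs → n H ≤ maxSize Gs
iso-member-size {Gs = G ∷ Gs} (here H≅G) = ≤-trans (iso-size {G = G} H≅G) (m≤m⊔n (n G) (maxSize Gs))
iso-member-size {Gs = G ∷ Gs} (there H∈Gs) = ≤-trans (iso-member-size H∈Gs) (m≤n⊔m (n G) (maxSize Gs))

contains-refl : ∀ {G} → Contains G G
contains-refl = id , (λ _ _ i<j → i<j) , (λ _ _ e → e)

contains-matching : ∀ {G H} → Contains G H → IsMatching G → IsMatching H
contains-matching {G} {H} (f , mono , edge) matching v u w v~u v~w =
  strictMono-injective mono (matching (f v) (f u) (f w) (adj-map v~u) (adj-map v~w))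
  where
  adj-map : ∀ {x y} → Adj H x y → Adj G (f x) (f y)
  adj-map (inj₁ e) = inj₁ (edge _ _ e)
  adj-map (inj₂ e) = inj₂ (edge _ _ e)

contains-mn : ∀ {G H} → Contains G H → MnAtMost k G → MnAtMost k H
contains-mn (f , mono , edge) (s , q , s+q≤k , c , stack , queue) =
    s , q , s+q≤k , (λ u v → c (f u) (f v))
  , (λ u v x y σ e e′ cσ c′σ → stack _ _ _ _ σ (edge _ _ e) (edge _ _ e′) cσ c′σ ∘ strictMono-cross mono)
  , (λ u v x y β e e′ cβ c′β → queue _ _ _ _ β (edge _ _ e) (edge _ _ e′) cβ c′β ∘ strictMono-nest mono)

witness : ∀ {A : Set} (d : Dec A) → does d ≡ true → A
witness (yes a) _ = a

kept? : (G : OGraph) (p u v : Fin (n G)) → Dec ((adj G u v ≡ true × u ≢ p) × v ≢ p)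
kept? G p u v = (adj G u v Boolₚ.≟ true ×-dec ¬? (u Finₚ.≟ p)) ×-dec ¬? (v Finₚ.≟ p)

isolate : (G : OGraph) → Fin (n G) → OGraph
isolate G p = ograph (n G) λ u v → does (kept? G p u v)

isolate-edge : ∀ {G p u v} → Edge (isolate G p) u v → Edge G u v × u ≢ p
isolate-edge {G} {p} {u} {v} (u<v , e) with (adj≡true , u≢p) , _ ← witness (kept? G p u v) e = (u<v , adj≡true) , u≢p

contains-isolate : ∀ {G H p} ((f , _) : Contains G H) → (∀ a → f a ≢ p) → Contains (isolate G p) H
contains-isolate {G} {p = p} (f , mono , edge) missed =
  f , mono , λ i j e → proj₁ (edge i j e) , dec-true (kept? G p (f i) (f j)) ((proj₂ (edge i j e) , missed i) , missed j)

combine-monoʳ-< : ∀ {m n} (i : Fin m) {j j′ : Fin n} → toℕ j < toℕ j′ → toℕ (combine i j) < toℕ (combine i j′)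
combine-monoʳ-< {n = n} i {j} {j′} j<j′ =
  subst₂ _<_ (sym (Finₚ.toℕ-combine i j)) (sym (Finₚ.toℕ-combine i j′)) (+-monoʳ-< (n * toℕ i) j<j′)

opposite-anti : ∀ {n} {j j′ : Fin n} → toℕ j < toℕ j′ → toℕ (opposite j′) < toℕ (opposite j)
opposite-anti {j = j} {j′} j<j′ =
  subst₂ _<_ (sym (Finₚ.opposite-prop j′)) (sym (Finₚ.opposite-prop j)) (∸-monoʳ-< (s<s j<j′) (Finₚ.toℕ<n j′))

opposite-injective : ∀ {n} {j j′ : Fin n} → opposite j ≡ opposite j′ → j ≡ j′
opposite-injective {j = j} {j′} eq =
  trans (sym (Finₚ.opposite-involutive j)) (trans (cong opposite eq) (Finₚ.opposite-involutive j′))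

literal< : ∀ {a b} {_ : T (a <ᵇ b)} → a < b
literal< {a} {b} {a<ᵇb} = <ᵇ⇒< a b a<ᵇb

path-offsets-cross : ∀ a → Crossℕ (2 * a) (3 + 2 * a) (2 + 2 * a) (5 + 2 * a)
path-offsets-cross a = inj₁ (m<n+m (2 * a) {2} z<s , n<1+n _ , m<n+m (3 + 2 * a) {2} z<s)

interleaved-offsets : 2 * a < 2 * b → 2 * b < 3 + 2 * a → b ≡ suc a
interleaved-offsets {a} {b} p q =
  ≤-antisym (*-cancelˡ-≤ 2 (subst (2 * b ≤_) (sym (*-suc 2 a)) (s≤s⁻¹ q))) (*-cancelˡ-< 2 a b p)

path-offsets-cross⁻¹ : Crossℕ (2 * a) (3 + 2 * a) (2 * b) (3 + 2 * b) → b ≡ suc a ⊎ a ≡ suc b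
path-offsets-cross⁻¹ (inj₁ (p , q , _)) = inj₁ (interleaved-offsets p q)
path-offsets-cross⁻¹ (inj₂ (p , q , _)) = inj₂ (interleaved-offsets p q)

closer-offsets-cross⁻¹ : a ≤ b → Crossℕ (2 * a) (3 + 2 * a) 1 (2 + 2 * b) → a ≡ 0 ⊎ a ≡ b
closer-offsets-cross⁻¹ {zero} _ _ = inj₁ refl
closer-offsets-cross⁻¹ {suc a} _ (inj₁ (s≤s () , _))
closer-offsets-cross⁻¹ a≤b (inj₂ (_ , _ , r)) =
  inj₂ (≤-antisym a≤b (*-cancelˡ-≤ 2 (s≤s⁻¹ (s≤s⁻¹ (s≤s⁻¹ r)))))

tight-split : a + b ≤ 2 + k → 2 ≤ a → k ≤ b → ¬ (3 ≤ a ⊎ suc k ≤ b)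
tight-split bound 2≤a k≤b (inj₁ 3≤a) = 1+n≰n (≤-trans (+-mono-≤ 3≤a k≤b) bound)
tight-split bound 2≤a k≤b (inj₂ 1+k≤b) = 1+n≰n (≤-trans (+-mono-≤ 2≤a 1+k≤b) bound)

repeated-colour : s + q < k → (g : Fin k → Fin s ⊎ Fin q) → ∃₂ λ j j′ → toℕ j < toℕ j′ × g j ≡ g j′
repeated-colour {s} {q} s+q<k g with j , j′ , j<j′ , eq ← Finₚ.pigeonhole s+q<k (join s q ∘ g) =
  j , j′ , j<j′ , trans (sym (Finₚ.splitAt-join s q (g j))) (trans (cong (splitAt s) eq) (Finₚ.splitAt-join s q (g j′)))

<-distinct⇒injective : ∀ {A : Set} (g : Fin k → A) →
                       (∀ {i i′} → toℕ i < toℕ i′ → g i ≢ g i′) → Injective _≡_ _≡_ g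
<-distinct⇒injective g distinct {i} {i′} eq with Finₚ.<-cmp i i′
... | tri< i<i′ _ _ = contradiction eq (distinct i<i′)
... | tri≈ _ i≡i′ _ = i≡i′
... | tri> _ _ i′<i = contradiction (sym eq) (distinct i′<i)

cons-injective : ∀ {A : Set} {x : A} {f : Vector A k} →
                 (∀ i → x ≢ f i) → Injective _≡_ _≡_ f → Injective _≡_ _≡_ (x ∷ᵥ f)
cons-injective fresh inj {zero} {zero} _ = refl
cons-injective fresh inj {zero} {suc j} eq = contradiction eq (fresh j)
cons-injective fresh inj {suc i} {zero} eq = contradiction (sym eq) (fresh i)
cons-injective fresh inj {suc i} {suc j} eq = cong suc (inj eq)

module _ {A : Set} (a b : A) where

  Two : A → Set
  Two x = x ≡ a ⊎ x ≡ b

  two-values : ∀ {x y z} → Two x → Two y → Two z → x ≢ y → y ≢ z → x ≡ z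
  two-values (inj₁ refl) _ (inj₁ refl) _ _ = refl
  two-values (inj₂ refl) _ (inj₂ refl) _ _ = refl
  two-values (inj₁ refl) (inj₁ refl) (inj₂ refl) x≢y _ = contradiction refl x≢y
  two-values (inj₁ refl) (inj₂ refl) (inj₂ refl) _ y≢z = contradiction refl y≢z
  two-values (inj₂ refl) (inj₂ refl) (inj₁ refl) x≢y _ = contradiction refl x≢y
  two-values (inj₂ refl) (inj₁ refl) (inj₁ refl) _ y≢z = contradiction refl y≢z

  odd-path-ends-differ : (f : ℕ → A) (m : ℕ) → (∀ i → Two (f i)) →
                         (∀ i → i < suc (2 * m) → f i ≢ f (suc i)) → f (suc (2 * m)) ≢ f 0
  odd-path-ends-differ f m two alternate fn≡f0 = alternate 0 z<s (trans (sym fn≡f0) (odd m ≤-refl))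
    where
    step : ∀ i → 2 + i ≤ suc (2 * m) → f (2 + i) ≡ f i
    step i bound = sym (two-values (two i) (two (suc i)) (two (2 + i)) (alternate i (<⇒≤ bound)) (alternate (suc i) bound))
    odd : ∀ j → suc (2 * j) ≤ suc (2 * m) → f (suc (2 * j)) ≡ f 1
    odd zero _ = refl
    odd (suc j) bound = trans (cong f 2j+3≡) (trans (step (suc (2 * j)) bound′) (odd j (≤-trans (m≤n+m _ 2) bound′)))
      where
      2j+3≡ : suc (2 * suc j) ≡ 2 + suc (2 * j)
      2j+3≡ = cong suc (*-suc 2 j)
      bound′ : 2 + suc (2 * j) ≤ suc (2 * m)
      bound′ = subst (_≤ suc (2 * m)) 2j+3≡ bound

parity : ℕ → Fin 2
parity zero = zero
parity (suc zero) = suc zero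
parity (suc (suc n)) = parity n

parity-suc : ∀ n → parity (suc n) ≢ parity n
parity-suc zero ()
parity-suc (suc zero) ()
parity-suc (suc (suc n)) = parity-suc n

missed-by : ∀ {A : Set} → a < b → (f : Fin a → A) (g : Fin b → A) → Injective _≡_ _≡_ g →
            DecidableEquality A → ∃ λ j → ∀ i → f i ≢ g j
missed-by {a} a<b f g g-injective _≟_ with Finₚ.any? (λ j → Finₚ.all? λ i → ¬? (f i ≟ g j))
... | yes found = found
... | no none = contradiction (Finₚ.injective⇒≤ hit-injective) (<⇒≱ a<b)
  where
  hit : ∀ j → ∃ λ i → f i ≡ g j
  hit j with i , ¬≢ ← Finₚ.¬∀⟶∃¬ a _ (λ i → ¬? (f i ≟ g j)) (λ ∀≢ → none (j , ∀≢)) =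
    i , decidable-stable (f i ≟ g j) ¬≢
  hit-injective : Injective _≡_ _≡_ (proj₁ ∘ hit)
  hit-injective {j} {j′} same = g-injective (trans (sym (proj₂ (hit j))) (trans (cong f same) (proj₂ (hit j′))))

module Construction (t m : ℕ) where

  K L : ℕ
  K = 3 + t
  L = suc (2 * m)

  -- The vertices 0 … N-1 are cut into seven consecutive bands of the given sizes.  A chord with
  -- code in Code l r has its left end in band l and its right end in band r: t groups of K
  -- pairwise crossing twists, mutually nested, run from band 0 to band 6; inside them two
  -- rainbows of K pairwise nesting chords, from band 1 to 4 and from band 2 to 5, cross each
  -- other; band 3 holds the path chords at offsets (2i, 2i+3), each crossing the next, closed
  -- into a crossing cycle of odd length L + 2 by the closer at offsets (1, 2L+2).  Indexing codes
  -- by their bands lets Agda discard code pairs whose bands disagree.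
  band-size : ℕ → ℕ
  band-size 0 = t * K
  band-size 1 = K
  band-size 2 = K
  band-size 3 = 4 + 2 * L
  band-size 4 = K
  band-size 5 = K
  band-size 6 = t * K
  band-size _ = 0

  band-start : ℕ → ℕ
  band-start zero = 0
  band-start (suc b) = band-start b + band-size b

  N : ℕ
  N = band-start 7

  data Code : ℕ → ℕ → Set where
    twist    : Fin t → Fin K → Code 0 6
    rainbow₁ : Fin K → Code 1 4
    rainbow₂ : Fin K → Code 2 5
    path     : Fin (suc L) → Code 3 3
    closer   : Code 3 3

  data Chord : Set where
    ⟨_⟩ : ∀ {l r} → Code l r → Chord

  offsetL offsetR : ∀ {l r} → Code l r → ℕ
  offsetL (twist i j) = toℕ (combine i j)
  offsetL (rainbow₁ j) = toℕ j
  offsetL (rainbow₂ j) = toℕ j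
  offsetL (path i) = 2 * toℕ i
  offsetL closer = 1
  offsetR (twist i j) = toℕ (combine (opposite i) j)
  offsetR (rainbow₁ j) = toℕ (opposite j)
  offsetR (rainbow₂ j) = toℕ (opposite j)
  offsetR (path i) = 3 + 2 * toℕ i
  offsetR closer = 2 + 2 * L

  index≤L : (i : Fin (suc L)) → 2 * toℕ i ≤ 2 * L
  index≤L i = *-monoʳ-≤ 2 (s≤s⁻¹ (Finₚ.toℕ<n i))

  offsetL< : ∀ {l r} (c : Code l r) → offsetL c < band-size l
  offsetL< (twist i j) = Finₚ.toℕ<n (combine i j)
  offsetL< (rainbow₁ j) = Finₚ.toℕ<n j
  offsetL< (rainbow₂ j) = Finₚ.toℕ<n j
  offsetL< (path i) = ≤-trans (s≤s (index≤L i)) (m≤n+m _ 3)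
  offsetL< closer = literal<

  offsetR< : ∀ {l r} (c : Code l r) → offsetR c < band-size r
  offsetR< (twist i j) = Finₚ.toℕ<n (combine (opposite i) j)
  offsetR< (rainbow₁ j) = Finₚ.toℕ<n (opposite j)
  offsetR< (rainbow₂ j) = Finₚ.toℕ<n (opposite j)
  offsetR< (path i) = s≤s (s≤s (s≤s (s≤s (index≤L i))))
  offsetR< closer = s≤s (s≤s (s≤s (n≤1+n _)))

  band-start-mono : ∀ {b b′} → b ≤ b′ → band-start b ≤ band-start b′
  band-start-mono = go ∘ ≤⇒≤′
    where
    go : ∀ {b b′} → b ≤′ b′ → band-start b ≤ band-start b′
    go (≤′-reflexive refl) = ≤-refl
    go (≤′-step b≤′b′) = ≤-trans (go b≤′b′) (m≤m+n _ _)

  band< : ∀ b b′ {x y} → b < b′ → x < band-size b → band-start b + x < band-start b′ + y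
  band< b b′ {x} {y} b<b′ x<size = begin-strict
    band-start b + x     <⟨ +-monoʳ-< (band-start b) x<size ⟩
    band-start (suc b)   ≤⟨ band-start-mono b<b′ ⟩
    band-start b′        ≤⟨ m≤m+n (band-start b′) y ⟩
    band-start b′ + y    ∎
    where open ≤-Reasoning

  band-unique : ∀ {b b′ x y} → x < band-size b → y < band-size b′ →
                band-start b + x ≡ band-start b′ + y → b ≡ b′
  band-unique {b} {b′} x<size y<size eq with <-cmp b b′
  ... | tri< b<b′ _ _ = contradiction eq (<⇒≢ (band< b b′ b<b′ x<size))
  ... | tri≈ _ b≡b′ _ = b≡b′
  ... | tri> _ _ b′<b = contradiction (sym eq) (<⇒≢ (band< b′ b b′<b y<size))

  bands<7 : ∀ {l r} → Code l r → l < 7 × r < 7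
  bands<7 (twist _ _) = literal< , literal<
  bands<7 (rainbow₁ _) = literal< , literal<
  bands<7 (rainbow₂ _) = literal< , literal<
  bands<7 (path _) = literal< , literal<
  bands<7 closer = literal< , literal<

  endL endR : Chord → ℕ
  endL (⟨_⟩ {l} c) = band-start l + offsetL c
  endR (⟨_⟩ {r = r} c) = band-start r + offsetR c

  endL<N : ∀ κ → endL κ < N
  endL<N κ@(⟨_⟩ {l} c) = subst (endL κ <_) (+-identityʳ N) (band< l 7 (proj₁ (bands<7 c)) (offsetL< c))

  endR<N : ∀ κ → endR κ < N
  endR<N κ@(⟨_⟩ {r = r} c) = subst (endR κ <_) (+-identityʳ N) (band< r 7 (proj₂ (bands<7 c)) (offsetR< c))

  same-offsetL : ∀ {l r r′} (c : Code l r) (c′ : Code l r′) → offsetL c ≡ offsetL c′ → ⟨ c ⟩ ≡ ⟨ c′ ⟩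
  same-offsetL (twist i j) (twist i′ j′) eq
    with refl , refl ← Finₚ.combine-injective i j i′ j′ (Finₚ.toℕ-injective eq) = refl
  same-offsetL (rainbow₁ j) (rainbow₁ j′) eq with refl ← Finₚ.toℕ-injective {i = j} {j′} eq = refl
  same-offsetL (rainbow₂ j) (rainbow₂ j′) eq with refl ← Finₚ.toℕ-injective {i = j} {j′} eq = refl
  same-offsetL (path i) (path i′) eq with refl ← Finₚ.toℕ-injective {i = i} {i′} (*-cancelˡ-≡ _ _ 2 eq) = refl
  same-offsetL (path i) closer eq = contradiction eq (even≢odd (toℕ i) 0)
  same-offsetL closer (path i) eq = contradiction (sym eq) (even≢odd (toℕ i) 0)
  same-offsetL closer closer _ = refl

  same-offsetR : ∀ {l l′ r} (c : Code l r) (c′ : Code l′ r) → offsetR c ≡ offsetR c′ → ⟨ c ⟩ ≡ ⟨ c′ ⟩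
  same-offsetR (twist i j) (twist i′ j′) eq
    with o≡o′ , refl ← Finₚ.combine-injective _ j _ j′ (Finₚ.toℕ-injective eq)
    with refl ← opposite-injective {j = i} {i′} o≡o′ = refl
  same-offsetR (rainbow₁ j) (rainbow₁ j′) eq
    with refl ← opposite-injective {j = j} {j′} (Finₚ.toℕ-injective eq) = refl
  same-offsetR (rainbow₂ j) (rainbow₂ j′) eq
    with refl ← opposite-injective {j = j} {j′} (Finₚ.toℕ-injective eq) = refl
  same-offsetR (path i) (path i′) eq
    with refl ← Finₚ.toℕ-injective {i = i} {i′} (*-cancelˡ-≡ _ _ 2 (+-cancelˡ-≡ 3 _ _ eq)) = refl
  same-offsetR (path i) closer eq = contradiction (sym (suc-injective (suc-injective eq))) (even≢odd L (toℕ i))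
  same-offsetR closer (path i) eq = contradiction (suc-injective (suc-injective eq)) (even≢odd L (toℕ i))
  same-offsetR closer closer _ = refl

  offsetL≢offsetR : ∀ {l r l′} (c : Code l r) (c′ : Code l′ l) → offsetL c ≢ offsetR c′
  offsetL≢offsetR (twist _ _) ()
  offsetL≢offsetR (rainbow₁ _) ()
  offsetL≢offsetR (rainbow₂ _) ()
  offsetL≢offsetR (path i) (path i′) eq =
    even≢odd (toℕ i) (suc (toℕ i′)) (trans eq (cong suc (sym (*-suc 2 (toℕ i′)))))
  offsetL≢offsetR (path i) closer eq = <⇒≢ (<-≤-trans (s≤s (index≤L i)) (n≤1+n _)) eq
  offsetL≢offsetR closer (path _) ()
  offsetL≢offsetR closer closer ()

  endL-injective : ∀ {κ κ′} → endL κ ≡ endL κ′ → κ ≡ κ′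
  endL-injective {⟨_⟩ {l} c} {⟨_⟩ {l′} c′} eq with refl ← band-unique {l} {l′} (offsetL< c) (offsetL< c′) eq =
    same-offsetL c c′ (+-cancelˡ-≡ _ _ _ eq)

  endR-injective : ∀ {κ κ′} → endR κ ≡ endR κ′ → κ ≡ κ′
  endR-injective {⟨_⟩ {r = r} c} {⟨_⟩ {r = r′} c′} eq
    with refl ← band-unique {r} {r′} (offsetR< c) (offsetR< c′) eq =
    same-offsetR c c′ (+-cancelˡ-≡ _ _ _ eq)

  endL≢endR : ∀ κ κ′ → endL κ ≢ endR κ′
  endL≢endR (⟨_⟩ {l} c) (⟨_⟩ {r = r′} c′) eq with refl ← band-unique {l} {r′} (offsetL< c) (offsetR< c′) eq =
    offsetL≢offsetR c c′ (+-cancelˡ-≡ _ _ _ eq)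

  Crosses Nests : Chord → Chord → Set
  Crosses κ κ′ = Crossℕ (endL κ) (endR κ) (endL κ′) (endR κ′)
  Nests κ κ′ = Nestℕ (endL κ) (endR κ) (endL κ′) (endR κ′)

  within-band : ∀ b {x y} → x < y → band-start b + x < band-start b + y
  within-band b = +-monoʳ-< (band-start b)

  endL<endR : ∀ κ → endL κ < endR κ
  endL<endR ⟨ c@(twist _ _) ⟩ = band< 0 6 literal< (offsetL< c)
  endL<endR ⟨ c@(rainbow₁ _) ⟩ = band< 1 4 literal< (offsetL< c)
  endL<endR ⟨ c@(rainbow₂ _) ⟩ = band< 2 5 literal< (offsetL< c)
  endL<endR ⟨ path i ⟩ = within-band 3 (m<n+m (2 * toℕ i) {3} z<s)
  endL<endR ⟨ closer ⟩ = within-band 3 (s≤s (s≤s z≤n))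

  twists-cross : ∀ i {j j′} → toℕ j < toℕ j′ → Crosses ⟨ twist i j ⟩ ⟨ twist i j′ ⟩
  twists-cross i j<j′ =
    inj₁ ( within-band 0 (combine-monoʳ-< i j<j′)
         , band< 0 6 literal< (offsetL< (twist i _))
         , within-band 6 (combine-monoʳ-< (opposite i) j<j′))

  twist-groups-nest : ∀ {i i′} j j′ → toℕ i < toℕ i′ → Nests ⟨ twist i j ⟩ ⟨ twist i′ j′ ⟩
  twist-groups-nest j j′ i<i′ =
    inj₁ ( within-band 0 (Finₚ.combine-monoˡ-< j j′ i<i′)
         , endL<endR ⟨ twist _ j′ ⟩
         , within-band 6 (Finₚ.combine-monoˡ-< j′ j (opposite-anti i<i′)))

  rainbow₁-nests : ∀ {j j′} → toℕ j < toℕ j′ → Nests ⟨ rainbow₁ j ⟩ ⟨ rainbow₁ j′ ⟩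
  rainbow₁-nests {j′ = j′} j<j′ =
    inj₁ (within-band 1 j<j′ , endL<endR ⟨ rainbow₁ j′ ⟩ , within-band 4 (opposite-anti j<j′))

  rainbow₂-nests : ∀ {j j′} → toℕ j < toℕ j′ → Nests ⟨ rainbow₂ j ⟩ ⟨ rainbow₂ j′ ⟩
  rainbow₂-nests {j′ = j′} j<j′ =
    inj₁ (within-band 2 j<j′ , endL<endR ⟨ rainbow₂ j′ ⟩ , within-band 5 (opposite-anti j<j′))

  rainbows-cross : ∀ j j′ → Crosses ⟨ rainbow₁ j ⟩ ⟨ rainbow₂ j′ ⟩
  rainbows-cross j j′ =
    inj₁ ( band< 1 2 literal< (offsetL< (rainbow₁ j))
         , band< 2 4 literal< (offsetL< (rainbow₂ j′))
         , band< 4 5 literal< (offsetR< (rainbow₁ j)))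

  encloses : ∀ {l r} (c : Code l r) (x : Code 3 3) → l < 3 → 3 < r → Nests ⟨ c ⟩ ⟨ x ⟩
  encloses {l} {r} c x l<3 3<r = inj₁ (band< l 3 l<3 (offsetL< c) , endL<endR ⟨ x ⟩ , band< 3 r 3<r (offsetR< x))

  paths-cross : ∀ {i i′} → suc (toℕ i) ≡ toℕ i′ → Crosses ⟨ path i ⟩ ⟨ path i′ ⟩
  paths-cross {i} i+1≡i′ rewrite sym i+1≡i′ | *-suc 2 (toℕ i) =
    cross-shift (band-start 3) (path-offsets-cross (toℕ i))

  2≤2L : 2 ≤ 2 * L
  2≤2L = *-monoʳ-≤ 2 (s≤s z≤n)

  path₀-crosses-closer : ∀ {i} → toℕ i ≡ 0 → Crosses ⟨ path i ⟩ ⟨ closer ⟩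
  path₀-crosses-closer i≡0 rewrite i≡0 =
    cross-shift (band-start 3) (inj₁ (z<s , s≤s (s≤s z≤n) , s≤s (s≤s 2≤2L)))

  closer-crosses-pathL : ∀ {i} → toℕ i ≡ L → Crosses ⟨ closer ⟩ ⟨ path i ⟩
  closer-crosses-pathL i≡L rewrite i≡L =
    cross-shift (band-start 3) (inj₁ (2≤2L , m<n+m (2 * L) {2} z<s , n<1+n _))

  paths-cross⁻¹ : ∀ {i i′} → Crosses ⟨ path i ⟩ ⟨ path i′ ⟩ →
                  toℕ i′ ≡ suc (toℕ i) ⊎ toℕ i ≡ suc (toℕ i′)
  paths-cross⁻¹ = path-offsets-cross⁻¹ ∘ cross-unshift (band-start 3)

  path-closer-cross⁻¹ : ∀ {i} → Crosses ⟨ path i ⟩ ⟨ closer ⟩ → toℕ i ≡ 0 ⊎ toℕ i ≡ L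
  path-closer-cross⁻¹ {i} = closer-offsets-cross⁻¹ (s≤s⁻¹ (Finₚ.toℕ<n i)) ∘ cross-unshift (band-start 3)

  -- The ordered matching M

  posL posR : Chord → Fin N
  posL κ = fromℕ< (endL<N κ)
  posR κ = fromℕ< (endR<N κ)

  toℕ-posL : ∀ κ → toℕ (posL κ) ≡ endL κ
  toℕ-posL κ = Finₚ.toℕ-fromℕ< (endL<N κ)

  toℕ-posR : ∀ κ → toℕ (posR κ) ≡ endR κ
  toℕ-posR κ = Finₚ.toℕ-fromℕ< (endR<N κ)

  posL-injective : ∀ {κ κ′} → posL κ ≡ posL κ′ → κ ≡ κ′
  posL-injective {κ} {κ′} eq = endL-injective (trans (sym (toℕ-posL κ)) (trans (cong toℕ eq) (toℕ-posL κ′)))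

  posR-injective : ∀ {κ κ′} → posR κ ≡ posR κ′ → κ ≡ κ′
  posR-injective {κ} {κ′} eq = endR-injective (trans (sym (toℕ-posR κ)) (trans (cong toℕ eq) (toℕ-posR κ′)))

  posL≢posR : ∀ κ κ′ → posL κ ≢ posR κ′
  posL≢posR κ κ′ eq = endL≢endR κ κ′ (trans (sym (toℕ-posL κ)) (trans (cong toℕ eq) (toℕ-posR κ′)))

  any-chord? : {P : Chord → Set} → (∀ κ → Dec (P κ)) → Dec (∃ P)
  any-chord? {P} P? =
    map′ from to ( (Finₚ.any? λ i → Finₚ.any? λ j → P? ⟨ twist i j ⟩)
                 ⊎-dec (Finₚ.any? λ j → P? ⟨ rainbow₁ j ⟩)
                 ⊎-dec (Finₚ.any? λ j → P? ⟨ rainbow₂ j ⟩)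
                 ⊎-dec (Finₚ.any? λ i → P? ⟨ path i ⟩)
                 ⊎-dec P? ⟨ closer ⟩)
    where
    ByFamily : Set
    ByFamily = (∃₂ λ i j → P ⟨ twist i j ⟩) ⊎ (∃ λ j → P ⟨ rainbow₁ j ⟩)
             ⊎ (∃ λ j → P ⟨ rainbow₂ j ⟩) ⊎ (∃ λ i → P ⟨ path i ⟩) ⊎ P ⟨ closer ⟩
    from : ByFamily → ∃ P
    from (inj₁ (_ , _ , p)) = _ , p
    from (inj₂ (inj₁ (_ , p))) = _ , p
    from (inj₂ (inj₂ (inj₁ (_ , p)))) = _ , p
    from (inj₂ (inj₂ (inj₂ (inj₁ (_ , p))))) = _ , p
    from (inj₂ (inj₂ (inj₂ (inj₂ p)))) = _ , p
    to : ∃ P → ByFamily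
    to (⟨ twist i j ⟩ , p) = inj₁ (i , j , p)
    to (⟨ rainbow₁ j ⟩ , p) = inj₂ (inj₁ (j , p))
    to (⟨ rainbow₂ j ⟩ , p) = inj₂ (inj₂ (inj₁ (j , p)))
    to (⟨ path i ⟩ , p) = inj₂ (inj₂ (inj₂ (inj₁ (i , p))))
    to (⟨ closer ⟩ , p) = inj₂ (inj₂ (inj₂ (inj₂ p)))

  Joins : Fin N → Fin N → Chord → Set
  Joins u v κ = posL κ ≡ u × posR κ ≡ v

  joins? : ∀ u v → Dec (∃ (Joins u v))
  joins? u v = any-chord? λ κ → posL κ Finₚ.≟ u ×-dec posR κ Finₚ.≟ v

  -- Opaque, so that unification never unfolds the search over all chords.
  opaque
    adjacent : Fin N → Fin N → Bool
    adjacent u v = does (joins? u v)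

    chord-adjacent : ∀ κ → adjacent (posL κ) (posR κ) ≡ true
    chord-adjacent κ = dec-true (joins? (posL κ) (posR κ)) (κ , refl , refl)

    adjacent-chord : ∀ {u v} → adjacent u v ≡ true → ∃ (Joins u v)
    adjacent-chord {u} {v} = witness (joins? u v)

  M : OGraph
  M = ograph N adjacent

  chord-edge : ∀ κ → Edge M (posL κ) (posR κ)
  chord-edge κ = subst₂ _<_ (sym (toℕ-posL κ)) (sym (toℕ-posR κ)) (endL<endR κ) , chord-adjacent κ

  edge-chord : ∀ {u v} → Edge M u v → ∃ (Joins u v)
  edge-chord (_ , e) = adjacent-chord e

  Incident : Fin N → Fin N → Chord → Set
  Incident v u κ = Joins v u κ ⊎ Joins u v κ

  adj-chord : ∀ {v u} → Adj M v u → ∃ (Incident v u)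
  adj-chord (inj₁ e) = map₂ inj₁ (edge-chord e)
  adj-chord (inj₂ e) = map₂ inj₂ (edge-chord e)

  partner-unique : ∀ {v u w} → ∃ (Incident v u) → ∃ (Incident v w) → u ≡ w
  partner-unique (κ , inj₁ (l , r)) (κ′ , inj₁ (l′ , r′))
    with refl ← posL-injective {κ} {κ′} (trans l (sym l′)) =
    trans (sym r) r′
  partner-unique (κ , inj₂ (l , r)) (κ′ , inj₂ (l′ , r′))
    with refl ← posR-injective {κ} {κ′} (trans r (sym r′)) =
    trans (sym l) l′
  partner-unique (κ , inj₁ (l , _)) (κ′ , inj₂ (_ , r′)) = contradiction (trans l (sym r′)) (posL≢posR κ κ′)
  partner-unique (κ , inj₂ (_ , r)) (κ′ , inj₁ (l′ , _)) = contradiction (trans l′ (sym r)) (posL≢posR κ′ κ)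

  M-matching : IsMatching M
  M-matching v u w v~u v~w = partner-unique (adj-chord v~u) (adj-chord v~w)

  Crosses⇒Cross : ∀ κ κ′ → Crosses κ κ′ → Cross (posL κ) (posR κ) (posL κ′) (posR κ′)
  Crosses⇒Cross κ κ′ =
    subst₄ Crossℕ (sym (toℕ-posL κ)) (sym (toℕ-posR κ)) (sym (toℕ-posL κ′)) (sym (toℕ-posR κ′))

  Nests⇒Nest : ∀ κ κ′ → Nests κ κ′ → Nest (posL κ) (posR κ) (posL κ′) (posR κ′)
  Nests⇒Nest κ κ′ =
    subst₄ Nestℕ (sym (toℕ-posL κ)) (sym (toℕ-posR κ)) (sym (toℕ-posL κ′)) (sym (toℕ-posR κ′))

  Cross⇒Crosses : ∀ {u v x y} κ κ′ → Joins u v κ → Joins x y κ′ → Cross u v x y → Crosses κ κ′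
  Cross⇒Crosses κ κ′ (refl , refl) (refl , refl) =
    subst₄ Crossℕ (toℕ-posL κ) (toℕ-posR κ) (toℕ-posL κ′) (toℕ-posR κ′)

  Nest⇒Nests : ∀ {u v x y} κ κ′ → Joins u v κ → Joins x y κ′ → Nest u v x y → Nests κ κ′
  Nest⇒Nests κ κ′ (refl , refl) (refl , refl) =
    subst₄ Nestℕ (toℕ-posL κ) (toℕ-posR κ) (toℕ-posL κ′) (toℕ-posR κ′)

  -- mn(M) > 2 + t

  any-cycle-chord? : {P : Code 3 3 → Set} → (∀ x → Dec (P x)) → Dec (∃ P)
  any-cycle-chord? {P} P? = map′ from to (Finₚ.any? (P? ∘ path) ⊎-dec P? closer)
    where
    from : (∃ λ i → P (path i)) ⊎ P closer → ∃ P
    from (inj₁ (_ , p)) = _ , p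
    from (inj₂ p) = _ , p
    to : ∃ P → (∃ λ i → P (path i)) ⊎ P closer
    to (path i , p) = inj₁ (i , p)
    to (closer , p) = inj₂ p

  module Infeasible {s q} (s+q≤k : s + q ≤ 2 + t) (c : Fin N → Fin N → Fin s ⊎ Fin q)
    (stack : ∀ u v x y (σ : Fin s) → Edge M u v → Edge M x y →
             c u v ≡ inj₁ σ → c x y ≡ inj₁ σ → ¬ Cross u v x y)
    (queue : ∀ u v x y (β : Fin q) → Edge M u v → Edge M x y →
             c u v ≡ inj₂ β → c x y ≡ inj₂ β → ¬ Nest u v x y)
    where

    colour : Chord → Fin s ⊎ Fin q
    colour κ = c (posL κ) (posR κ)

    stack-uncrossed : ∀ κ κ′ {σ} → colour κ ≡ inj₁ σ → colour κ′ ≡ inj₁ σ → ¬ Crosses κ κ′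
    stack-uncrossed κ κ′ {σ} cσ c′σ =
      stack (posL κ) (posR κ) (posL κ′) (posR κ′) σ (chord-edge κ) (chord-edge κ′) cσ c′σ
      ∘ Crosses⇒Cross κ κ′

    queue-unnested : ∀ κ κ′ {β} → colour κ ≡ inj₂ β → colour κ′ ≡ inj₂ β → ¬ Nests κ κ′
    queue-unnested κ κ′ {β} cβ c′β =
      queue (posL κ) (posR κ) (posL κ′) (posR κ′) β (chord-edge κ) (chord-edge κ′) cβ c′β
      ∘ Nests⇒Nest κ κ′

    queue-in-crossing-family : (e : Fin K → Chord) →
                               (∀ {j j′} → toℕ j < toℕ j′ → Crosses (e j) (e j′)) →
                               ∃₂ λ j β → colour (e j) ≡ inj₂ β
    queue-in-crossing-family e cross with j , j′ , j<j′ , same ← repeated-colour (s≤s s+q≤k) (colour ∘ e)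
      with colour (e j) in cj
    ... | inj₁ σ = contradiction (cross j<j′) (stack-uncrossed (e j) (e j′) cj (sym same))
    ... | inj₂ β = j , β , cj

    stack-in-nesting-family : (e : Fin K → Chord) →
                              (∀ {j j′} → toℕ j < toℕ j′ → Nests (e j) (e j′)) →
                              ∃₂ λ j σ → colour (e j) ≡ inj₁ σ
    stack-in-nesting-family e nest with j , j′ , j<j′ , same ← repeated-colour (s≤s s+q≤k) (colour ∘ e)
      with colour (e j) in cj
    ... | inj₁ σ = j , σ , cj
    ... | inj₂ β = contradiction (nest j<j′) (queue-unnested (e j) (e j′) cj (sym same))

    twist-queue : ∀ i → ∃₂ λ j β → colour ⟨ twist i j ⟩ ≡ inj₂ β
    twist-queue i = queue-in-crossing-family (λ j → ⟨ twist i j ⟩) (twists-cross i)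

    β : Fin t → Fin q
    β i = proj₁ (proj₂ (twist-queue i))

    queued-twist : Fin t → Code 0 6
    queued-twist i = twist i (proj₁ (twist-queue i))

    queued-twist-β : ∀ i → colour ⟨ queued-twist i ⟩ ≡ inj₂ (β i)
    queued-twist-β i = proj₂ (proj₂ (twist-queue i))

    β-injective : Injective _≡_ _≡_ β
    β-injective = <-distinct⇒injective β λ {i} {i′} i<i′ βi≡βi′ →
      queue-unnested ⟨ queued-twist i ⟩ ⟨ queued-twist i′ ⟩
        (queued-twist-β i) (trans (queued-twist-β i′) (cong inj₂ (sym βi≡βi′))) (twist-groups-nest _ _ i<i′)

    rainbow₁-stack : ∃₂ λ j σ → colour ⟨ rainbow₁ j ⟩ ≡ inj₁ σ
    rainbow₁-stack = stack-in-nesting-family (λ j → ⟨ rainbow₁ j ⟩) rainbow₁-nests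

    rainbow₂-stack : ∃₂ λ j σ → colour ⟨ rainbow₂ j ⟩ ≡ inj₁ σ
    rainbow₂-stack = stack-in-nesting-family (λ j → ⟨ rainbow₂ j ⟩) rainbow₂-nests

    σ₁ σ₂ : Fin s
    σ₁ = proj₁ (proj₂ rainbow₁-stack)
    σ₂ = proj₁ (proj₂ rainbow₂-stack)

    σ : Vector (Fin s) 2
    σ = σ₁ ∷ᵥ σ₂ ∷ᵥ []ᵥ

    σ-injective : Injective _≡_ _≡_ σ
    σ-injective = cons-injective (λ { zero → σ₁≢σ₂ ; (suc ()) }) (cons-injective (λ ()) λ { {()} })
      where
      σ₁≢σ₂ : σ₁ ≢ σ₂
      σ₁≢σ₂ σ₁≡σ₂ =
        stack-uncrossed ⟨ rainbow₁ (proj₁ rainbow₁-stack) ⟩ ⟨ rainbow₂ (proj₁ rainbow₂-stack) ⟩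
          (proj₂ (proj₂ rainbow₁-stack)) (trans (proj₂ (proj₂ rainbow₂-stack)) (cong inj₁ (sym σ₁≡σ₂)))
          (rainbows-cross _ _)

    TwoStacks : Fin s ⊎ Fin q → Set
    TwoStacks = Two (inj₁ σ₁) (inj₁ σ₂)

    two-stacks? : ∀ x → Dec (TwoStacks x)
    two-stacks? x = colour≟ x (inj₁ σ₁) ⊎-dec colour≟ x (inj₁ σ₂)
      where
      colour≟ : DecidableEquality (Fin s ⊎ Fin q)
      colour≟ = Sumₚ.≡-dec Finₚ._≟_ Finₚ._≟_

    crossing-two-stacks-differ : ∀ κ κ′ → TwoStacks (colour κ) → Crosses κ κ′ → colour κ ≢ colour κ′
    crossing-two-stacks-differ κ κ′ (inj₁ cσ) cross same = stack-uncrossed κ κ′ cσ (trans (sym same) cσ) cross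
    crossing-two-stacks-differ κ κ′ (inj₂ cσ) cross same = stack-uncrossed κ κ′ cσ (trans (sym same) cσ) cross

    cycle-not-two-stacked : ¬ (∀ x → TwoStacks (colour ⟨ x ⟩))
    cycle-not-two-stacked two =
      closer≢fL (two-values _ _ (two closer) (two (p 0)) (two (p L)) closer≢f0 (path-ends ∘ sym))
      where
      p : ℕ → Code 3 3
      p i = path (i mod suc L)
      f : ℕ → Fin s ⊎ Fin q
      f i = colour ⟨ p i ⟩
      index : ∀ {i} → i < suc L → toℕ (i mod suc L) ≡ i
      index {i} i<1+L = trans (Finₚ.toℕ-fromℕ< (m%n<n i (suc L))) (m<n⇒m%n≡m i<1+L)
      alternate : ∀ i → i < L → f i ≢ f (suc i)
      alternate i i<L = crossing-two-stacks-differ ⟨ p i ⟩ ⟨ p (suc i) ⟩ (two (p i))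
        (paths-cross (trans (cong suc (index (m<n⇒m<1+n i<L))) (sym (index (s≤s i<L)))))
      path-ends : f L ≢ f 0
      path-ends = odd-path-ends-differ _ _ f m (two ∘ p) alternate
      closer≢f0 : colour ⟨ closer ⟩ ≢ f 0
      closer≢f0 = crossing-two-stacks-differ ⟨ p 0 ⟩ ⟨ closer ⟩ (two (p 0)) (path₀-crosses-closer (index z<s))
                  ∘ sym
      closer≢fL : colour ⟨ closer ⟩ ≢ f L
      closer≢fL =
        crossing-two-stacks-differ ⟨ closer ⟩ ⟨ p L ⟩ (two closer) (closer-crosses-pathL (index ≤-refl))

    third-colour : ∃ λ x → ¬ TwoStacks (colour ⟨ x ⟩)
    third-colour = decidable-stable (any-cycle-chord? λ x → ¬? (two-stacks? (colour ⟨ x ⟩))) λ none →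
      cycle-not-two-stacked λ x → decidable-stable (two-stacks? (colour ⟨ x ⟩)) λ ¬two → none (x , ¬two)

    extra-colour : ∀ x {γ} → colour ⟨ x ⟩ ≡ γ → ¬ TwoStacks γ → 3 ≤ s ⊎ suc t ≤ q
    extra-colour x {inj₁ γ} _ ¬two = inj₁ (Finₚ.injective⇒≤ (cons-injective fresh σ-injective))
      where
      fresh : ∀ i → γ ≢ σ i
      fresh zero γ≡σ₁ = ¬two (inj₁ (cong inj₁ γ≡σ₁))
      fresh (suc zero) γ≡σ₂ = ¬two (inj₂ (cong inj₁ γ≡σ₂))
    extra-colour x {inj₂ γ} cx _ = inj₂ (Finₚ.injective⇒≤ (cons-injective fresh β-injective))
      where
      fresh : ∀ i → γ ≢ β i
      fresh i γ≡βi =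
        queue-unnested ⟨ queued-twist i ⟩ ⟨ x ⟩ (queued-twist-β i) (trans cx (cong inj₂ γ≡βi))
          (encloses (queued-twist i) x literal< literal<)

    no-colouring : ⊥
    no-colouring = tight-split s+q≤k (Finₚ.injective⇒≤ σ-injective) (Finₚ.injective⇒≤ β-injective)
                     (extra-colour (proj₁ third-colour) refl (proj₂ third-colour))

  M-infeasible : ¬ MnAtMost (2 + t) M
  M-infeasible (s , q , s+q≤k , c , stack , queue) = Infeasible.no-colouring s+q≤k c stack queue

  -- Deleting one path chord

  module Feasible (e : Fin (suc L)) where

    E : ℕ
    E = toℕ e

    -- Path chords are coloured alternately counting from path 0 below e and from path L above e,
    -- so both neighbours of the closer get stack 0; the one forced clash falls on the deleted chord.
    path-stack : ℕ → Fin 2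
    path-stack a with a <? E
    ... | yes _ = parity a
    ... | no _ = parity (L ∸ a)

    path-stack-below : ∀ {a} → a < E → path-stack a ≡ parity a
    path-stack-below {a} a<E with a <? E
    ... | yes _ = refl
    ... | no a≮E = contradiction a<E a≮E

    path-stack-above : ∀ {a} → ¬ a < E → path-stack a ≡ parity (L ∸ a)
    path-stack-above {a} a≮E with a <? E
    ... | yes a<E = contradiction a<E a≮E
    ... | no _ = refl

    path-stack-alternates : ∀ {a} → suc a ≤ L → suc a ≢ E → path-stack a ≢ path-stack (suc a)
    path-stack-alternates {a} 1+a≤L 1+a≢E = by-position (a <? E) (suc a <? E)
      where
      open ≡-Reasoning
      by-position : Dec (a < E) → Dec (suc a < E) → path-stack a ≢ path-stack (suc a)
      by-position (yes a<E) (yes 1+a<E) same =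
        parity-suc a (sym (trans (sym (path-stack-below a<E)) (trans same (path-stack-below 1+a<E))))
      by-position (yes a<E) (no 1+a≮E) _ = 1+a≢E (≤-antisym a<E (≮⇒≥ 1+a≮E))
      by-position (no a≮E) (yes 1+a<E) _ = a≮E (<-trans (n<1+n a) 1+a<E)
      by-position (no a≮E) (no 1+a≮E) same = parity-suc (L ∸ suc a) (begin
        parity (suc (L ∸ suc a))  ≡⟨ cong parity (+-∸-assoc 1 1+a≤L) ⟨
        parity (L ∸ a)            ≡⟨ path-stack-above a≮E ⟨
        path-stack a              ≡⟨ same ⟩
        path-stack (suc a)        ≡⟨ path-stack-above 1+a≮E ⟩
        parity (L ∸ suc a)        ∎)

    path-stack-ends : ∀ {a} → a ≢ E → a ≡ 0 ⊎ a ≡ L → path-stack a ≡ zero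
    path-stack-ends a≢E (inj₁ refl) = path-stack-below (n≢0⇒n>0 (a≢E ∘ sym))
    path-stack-ends a≢E (inj₂ refl) =
      trans (path-stack-above (≤⇒≯ (s≤s⁻¹ (Finₚ.toℕ<n e)))) (cong parity (n∸n≡0 L))

    chord-colour : Chord → Fin 2 ⊎ Fin t
    chord-colour ⟨ twist i _ ⟩ = inj₂ i
    chord-colour ⟨ rainbow₁ _ ⟩ = inj₁ zero
    chord-colour ⟨ rainbow₂ _ ⟩ = inj₁ (suc zero)
    chord-colour ⟨ path i ⟩ = inj₁ (path-stack (toℕ i))
    chord-colour ⟨ closer ⟩ = inj₁ (suc zero)

    index≢E : ∀ {i} → ⟨ path i ⟩ ≢ ⟨ path e ⟩ → toℕ i ≢ E
    index≢E κ≢ = κ≢ ∘ cong (λ i → ⟨ path i ⟩) ∘ Finₚ.toℕ-injective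

    paths-uncrossed : ∀ i i′ → ⟨ path i ⟩ ≢ ⟨ path e ⟩ → ⟨ path i′ ⟩ ≢ ⟨ path e ⟩ →
                      path-stack (toℕ i) ≡ path-stack (toℕ i′) → ¬ Crosses ⟨ path i ⟩ ⟨ path i′ ⟩
    paths-uncrossed i i′ _ i′≢e same cross with paths-cross⁻¹ cross
    ... | inj₁ i′≡1+i = path-stack-alternates (subst (_≤ L) i′≡1+i (s≤s⁻¹ (Finₚ.toℕ<n i′)))
                          (subst (_≢ E) i′≡1+i (index≢E i′≢e)) (trans same (cong path-stack i′≡1+i))
    paths-uncrossed i i′ i≢e _ same cross | inj₂ i≡1+i′ =
      path-stack-alternates (subst (_≤ L) i≡1+i′ (s≤s⁻¹ (Finₚ.toℕ<n i)))
        (subst (_≢ E) i≡1+i′ (index≢E i≢e)) (trans (sym same) (cong path-stack i≡1+i′))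

    path-closer-uncrossed : ∀ i → ⟨ path i ⟩ ≢ ⟨ path e ⟩ → path-stack (toℕ i) ≡ suc zero →
                            ¬ Crosses ⟨ path i ⟩ ⟨ closer ⟩
    path-closer-uncrossed i i≢e stack₁ cross
      with () ← trans (sym (path-stack-ends (index≢E i≢e) (path-closer-cross⁻¹ cross))) stack₁

    rainbow₁-uncrossed : ∀ j (x : Code 3 3) → ¬ Crosses ⟨ rainbow₁ j ⟩ ⟨ x ⟩
    rainbow₁-uncrossed j x = nest⇒¬cross (encloses (rainbow₁ j) x literal< literal<)

    rainbow₂-uncrossed : ∀ j (x : Code 3 3) → ¬ Crosses ⟨ rainbow₂ j ⟩ ⟨ x ⟩
    rainbow₂-uncrossed j x = nest⇒¬cross (encloses (rainbow₂ j) x literal< literal<)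

    stacks-uncrossed : ∀ κ κ′ {σ} → κ ≢ ⟨ path e ⟩ → κ′ ≢ ⟨ path e ⟩ →
                       chord-colour κ ≡ inj₁ σ → chord-colour κ′ ≡ inj₁ σ → ¬ Crosses κ κ′
    stacks-uncrossed ⟨ twist _ _ ⟩ _ _ _ () _
    stacks-uncrossed _ ⟨ twist _ _ ⟩ _ _ _ ()
    stacks-uncrossed ⟨ rainbow₁ j ⟩ ⟨ rainbow₁ j′ ⟩ _ _ _ _ = nesting-family⇒¬cross _ _ rainbow₁-nests j j′
    stacks-uncrossed ⟨ rainbow₁ _ ⟩ ⟨ rainbow₂ _ ⟩ _ _ refl ()
    stacks-uncrossed ⟨ rainbow₁ j ⟩ ⟨ path i ⟩ _ _ _ _ = rainbow₁-uncrossed j (path i)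
    stacks-uncrossed ⟨ rainbow₁ _ ⟩ ⟨ closer ⟩ _ _ refl ()
    stacks-uncrossed ⟨ rainbow₂ _ ⟩ ⟨ rainbow₁ _ ⟩ _ _ refl ()
    stacks-uncrossed ⟨ rainbow₂ j ⟩ ⟨ rainbow₂ j′ ⟩ _ _ _ _ = nesting-family⇒¬cross _ _ rainbow₂-nests j j′
    stacks-uncrossed ⟨ rainbow₂ j ⟩ ⟨ path i ⟩ _ _ _ _ = rainbow₂-uncrossed j (path i)
    stacks-uncrossed ⟨ rainbow₂ j ⟩ ⟨ closer ⟩ _ _ _ _ = rainbow₂-uncrossed j closer
    stacks-uncrossed ⟨ path i ⟩ ⟨ rainbow₁ j ⟩ _ _ _ _ = rainbow₁-uncrossed j (path i) ∘ cross-sym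
    stacks-uncrossed ⟨ path i ⟩ ⟨ rainbow₂ j ⟩ _ _ _ _ = rainbow₂-uncrossed j (path i) ∘ cross-sym
    stacks-uncrossed ⟨ path i ⟩ ⟨ path i′ ⟩ i≢e i′≢e refl c′ =
      paths-uncrossed i i′ i≢e i′≢e (sym (Sumₚ.inj₁-injective c′))
    stacks-uncrossed ⟨ path i ⟩ ⟨ closer ⟩ i≢e _ refl c′ =
      path-closer-uncrossed i i≢e (sym (Sumₚ.inj₁-injective c′))
    stacks-uncrossed ⟨ closer ⟩ ⟨ rainbow₁ _ ⟩ _ _ refl ()
    stacks-uncrossed ⟨ closer ⟩ ⟨ rainbow₂ j ⟩ _ _ _ _ = rainbow₂-uncrossed j closer ∘ cross-sym
    stacks-uncrossed ⟨ closer ⟩ ⟨ path i ⟩ _ i≢e refl c′ =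
      path-closer-uncrossed i i≢e (Sumₚ.inj₁-injective c′) ∘ cross-sym
    stacks-uncrossed ⟨ closer ⟩ ⟨ closer ⟩ _ _ _ _ = cross-irrefl

    queues-unnested : ∀ κ κ′ {β} → chord-colour κ ≡ inj₂ β → chord-colour κ′ ≡ inj₂ β → ¬ Nests κ κ′
    queues-unnested ⟨ twist i j ⟩ ⟨ twist .i j′ ⟩ refl refl = crossing-family⇒¬nest _ _ (twists-cross i) j j′
    queues-unnested ⟨ rainbow₁ _ ⟩ _ () _
    queues-unnested ⟨ rainbow₂ _ ⟩ _ () _
    queues-unnested ⟨ path _ ⟩ _ () _
    queues-unnested ⟨ closer ⟩ _ () _
    queues-unnested ⟨ twist _ _ ⟩ ⟨ rainbow₁ _ ⟩ _ ()
    queues-unnested ⟨ twist _ _ ⟩ ⟨ rainbow₂ _ ⟩ _ ()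
    queues-unnested ⟨ twist _ _ ⟩ ⟨ path _ ⟩ _ ()
    queues-unnested ⟨ twist _ _ ⟩ ⟨ closer ⟩ _ ()

    decided-colour : ∀ {u v} → Dec (∃ (Joins u v)) → Fin 2 ⊎ Fin t
    decided-colour (yes (κ , _)) = chord-colour κ
    decided-colour (no _) = inj₁ zero

    decided-colour-joins : ∀ {u v} κ → Joins u v κ → (d : Dec (∃ (Joins u v))) →
                           decided-colour d ≡ chord-colour κ
    decided-colour-joins κ (l , _) (yes (κ′ , l′ , _)) =
      cong chord-colour (posL-injective {κ′} {κ} (trans l′ (sym l)))
    decided-colour-joins κ j (no none) = contradiction (κ , j) none

    opaque
      colouring : Fin N → Fin N → Fin 2 ⊎ Fin t
      colouring u v = decided-colour (joins? u v)

      colouring-joins : ∀ {u v} κ → Joins u v κ → colouring u v ≡ chord-colour κ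
      colouring-joins {u} {v} κ j = decided-colour-joins κ j (joins? u v)

    p : Fin N
    p = posL ⟨ path e ⟩

    KeptChord : Fin N → Fin N → Set
    KeptChord u v = ∃ λ κ → Joins u v κ × κ ≢ ⟨ path e ⟩

    kept-chord : ∀ {u v} → Edge (isolate M p) u v → KeptChord u v
    kept-chord {u} {v} uv
      with (uv-in-M , u≢p) ← isolate-edge {M} {p} {u} {v} uv
      with (κ , l , r) ← edge-chord uv-in-M =
      κ , (l , r) , u≢p ∘ trans (sym l) ∘ cong posL

    kept-stacks-uncrossed : ∀ {u v x y σ} → KeptChord u v → KeptChord x y →
                            colouring u v ≡ inj₁ σ → colouring x y ≡ inj₁ σ → ¬ Cross u v x y
    kept-stacks-uncrossed (κ , j , κ≢) (κ′ , j′ , κ′≢) cσ c′σ =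
      stacks-uncrossed κ κ′ κ≢ κ′≢
        (trans (sym (colouring-joins κ j)) cσ) (trans (sym (colouring-joins κ′ j′)) c′σ)
      ∘ Cross⇒Crosses κ κ′ j j′

    kept-queues-unnested : ∀ {u v x y β} → KeptChord u v → KeptChord x y →
                           colouring u v ≡ inj₂ β → colouring x y ≡ inj₂ β → ¬ Nest u v x y
    kept-queues-unnested (κ , j , _) (κ′ , j′ , _) cβ c′β =
      queues-unnested κ κ′ (trans (sym (colouring-joins κ j)) cβ) (trans (sym (colouring-joins κ′ j′)) c′β)
      ∘ Nest⇒Nests κ κ′ j j′

    isolated-mn : MnAtMost (2 + t) (isolate M p)
    isolated-mn = 2 , t , ≤-refl , colouring
      , (λ _ _ _ _ _ uv xy → kept-stacks-uncrossed (kept-chord uv) (kept-chord xy))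
      , (λ _ _ _ _ _ uv xy → kept-queues-unnested (kept-chord uv) (kept-chord xy))

  unhit-path : ∀ {a} → a ≤ m → (f : Fin a → Fin N) → ∃ λ e → ∀ i → f i ≢ posL ⟨ path e ⟩
  unhit-path a≤m f =
    missed-by (s≤s (≤-trans a≤m (≤-trans (m≤m+n m _) (n≤1+n _)))) f (posL ∘ ⟨_⟩ ∘ path)
      path-injective Finₚ._≟_
    where
    path-injective : Injective _≡_ _≡_ (posL ∘ ⟨_⟩ ∘ path)
    path-injective {i} {i′} eq with refl ← posL-injective {⟨ path i ⟩} {⟨ path i′ ⟩} eq = refl

theorem4 : (k : ℕ) → 2 ≤ k → (P : OGraph → Set) →
    (∀ H → P H → IsPattern H) →
    (∀ M → IsMatching M → (MnAtMost k M → Avoids M P) × (Avoids M P → MnAtMost k M)) →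
    ¬ FiniteUpToIso P
theorem4 (suc (suc t)) (s≤s (s≤s z≤n)) P _ characterisation (Gs , covered) =
  M-infeasible (proj₂ (characterisation M M-matching) M-avoids-P)
  where
  open Construction t (maxSize Gs)

  M-avoids-P : Avoids M P
  M-avoids-P (H , H∈P , M⊇H@(f , _)) =
    proj₁ (characterisation H (contains-matching M⊇H M-matching)) H-mn (H , H∈P , contains-refl)
    where
    unhit : ∃ λ e → ∀ i → f i ≢ posL ⟨ path e ⟩
    unhit = unhit-path (iso-member-size (covered H H∈P)) f
    H-mn : MnAtMost (2 + t) H
    H-mn = contains-mn (contains-isolate {M} M⊇H (proj₂ unhit)) (Feasible.isolated-mn (proj₁ unhit))
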